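{- Let $T$ be a rooted tree with vertex weights $w_i\ge 0$, vertex costs $s_i$ and threshold $w_0$ (with $w_i\le w_0$ for all $i$). Let $v$ be a vertex, let $i\in \mathsf{win}^{ - }_v$ and let $x=\mathsf{next}_v(i)$. Then $i\in \mathsf{win}^{ - }_x$ and $x=\mathsf{next}_x(i)$, and moreover $$\mathsf{cost}(v,i)-\mathsf{cost}(x,i)=\mathsf{cost}(v,x)-\mathsf{cost}(x,x).$$
   Context: $T_v$ is the subtree rooted at $v$. For $u\in T_v$, $T[v,u]$ is the set of vertices on the path from $v$ to $u$, and $T[v,u)$ is $T[v,u]\setminus\{u\}$ (so $T[v,v)=\emptyset$). A chain is a set of the form $T[v,u]$; a chain partition of $T_v$ is a partition of its vertex set into chains each of total weight $\sum w_j\le w_0$, and its cost is the sum over its chains of the maximum $s_j$ in the chain. The window $\mathsf{win}_v$ is the set of $u\in T_v$ with $\sum_{j\in T[v,u]}w_j\le w_0$. A vertex $u\in T_v$ is s-maximal (in $T_v$) if $s_p<s_u$ for every $p\in T[v,u)$. For $u\in T_v$, $u\neq v$, $\mathsf{next}_v(u)$ is the closest proper ancestor of $u$ in $T_v$ that is s-maximal in $T_v$. $\mathsf{win}^*_v$ is the set of s-maximal vertices (in $T_v$) of $\mathsf{win}_v$, and $\mathsf{win}^-_v=\mathsf{win}_v\setminus\mathsf{win}^*_v$. For $i\in\mathsf{win}_v$, $\mathsf{cost}(v,i)$ is the minimum cost of a chain partition of $T_v$ one of whose chains is $T[v,i]$.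
   Formalization: The vertex weights $w_i$, vertex costs $s_i$ and threshold $w_0$ take rational values. -}

module Defs where

open import Data.Nat using (ℕ)
open import Data.Fin using (Fin; _≟_)
open import Data.Maybe using (Maybe; just; nothing)
open import Data.List using (List; []; _∷_; map; foldr; filter; length)
open import Data.List.Relation.Unary.All using (All)
open import Data.List.Relation.Unary.Any using (Any)
open import Data.Rational using (ℚ; 0ℚ; _≤_; _<_; _⊔_; _+_)
open import Data.Product using (Σ; Σ-syntax; _×_)
open import Relation.Binary.PropositionalEquality using (_≡_; _≢_)
open import Relation.Nullary using (¬_)
import Data.List.Membership.DecPropositional as DecMem

-- Desc parent u v  :  u ∈ T_v  (u is v or a descendant of v);
-- a proof is the upward path u → parent u → … → v.
data Desc {n : ℕ} (parent : Fin n → Maybe (Fin n)) : Fin n → Fin n → Set where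
  here : ∀ {v} → Desc parent v v
  step : ∀ {u p v} → parent u ≡ just p → Desc parent p v → Desc parent u v

-- A rooted tree: unique parentless root which every vertex reaches by
-- following parents (this excludes cycles and makes the root unique).
record RootedTree (n : ℕ) : Set where
  field
    parent      : Fin n → Maybe (Fin n)
    root        : Fin n
    root-parent : parent root ≡ nothing
    reach       : ∀ u → Desc parent u root

record Instance (n : ℕ) : Set where
  field
    tree     : RootedTree n
    w        : Fin n → ℚ
    s        : Fin n → ℚ
    w0       : ℚ
    w-nonneg : ∀ i → 0ℚ ≤ w i
    w-le-w0  : ∀ i → w i ≤ w0

sumℚ : List ℚ → ℚ
sumℚ = foldr _+_ 0ℚ

module _ {n : ℕ} (I : Instance n) where
  open Instance I
  open RootedTree tree

  InT : Fin n → Fin n → Set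
  InT v u = Desc parent u v

  -- vertex list of the path T[v,u] (listed from u up to v)
  pathList : ∀ {u v} → Desc parent u v → List (Fin n)
  pathList {u} here         = u ∷ []
  pathList {u} (step _ d)   = u ∷ pathList d

  pathWeight : ∀ {u v} → Desc parent u v → ℚ
  pathWeight d = sumℚ (map w (pathList d))

  pathMaxS : ∀ {u v} → Desc parent u v → ℚ
  pathMaxS {u} here       = s u
  pathMaxS {u} (step _ d) = s u ⊔ pathMaxS d

  InPath : Fin n → Fin n → Fin n → Set
  InPath v u p = InT v p × InT p u

  InPathOpen : Fin n → Fin n → Fin n → Set
  InPathOpen v u p = InPath v u p × p ≢ u

  SMax : Fin n → Fin n → Set
  SMax v u = InT v u × (∀ p → InPathOpen v u p → s p < s u)

  Win : Fin n → Fin n → Set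
  Win v u = Σ[ d ∈ Desc parent u v ] (pathWeight d ≤ w0)

  WinStar : Fin n → Fin n → Set
  WinStar v u = Win v u × SMax v u

  WinMinus : Fin n → Fin n → Set
  WinMinus v u = Win v u × ¬ SMax v u

  -- IsNext v u x  :  x = next_v(u), i.e. x is a proper ancestor of u in T_v,
  -- s-maximal in T_v, and the closest such (every other proper ancestor p of u
  -- in T_v that is s-maximal in T_v is an ancestor of x).
  IsNext : Fin n → Fin n → Fin n → Set
  IsNext v u x =
    InPathOpen v u x × SMax v x ×
    (∀ p → InPathOpen v u p → SMax v p → InT p x)

  record Chain : Set where
    constructor chain
    field
      top  : Fin n
      bot  : Fin n
      path : Desc parent bot top

  open Chain public

  countContaining : Fin n → List Chain → ℕ
  countContaining u cs =
    length (filter (λ c → DecMem._∈?_ _≟_ u (pathList (path c))) cs)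

  ChainPartition : Fin n → List Chain → Set
  ChainPartition v cs =
    All (λ c → InT v (top c)) cs ×
    All (λ c → pathWeight (path c) ≤ w0) cs ×
    (∀ u → InT v u → countContaining u cs ≡ 1)

  partitionCost : List Chain → ℚ
  partitionCost cs = sumℚ (map (λ c → pathMaxS (path c)) cs)

  HasChain : Fin n → Fin n → List Chain → Set
  HasChain v i cs = Any (λ c → top c ≡ v × bot c ≡ i) cs

  -- IsCost v i c  :  c = cost(v,i), the minimum cost of a chain partition of
  -- T_v one of whose chains is T[v,i].
  IsCost : Fin n → Fin n → ℚ → Set
  IsCost v i c =
    (Σ[ cs ∈ List Chain ]
       (ChainPartition v cs × HasChain v i cs × partitionCost cs ≡ c)) ×
    (∀ cs → ChainPartition v cs → HasChain v i cs → c ≤ partitionCost cs)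

-- Every vertex of T[v,i] has s at most s_x: above x because x is s-maximal in T_v, and below x
-- because the first vertex there exceeding s_x would itself be s-maximal in T_v, hence either i
-- (excluded by i ∈ win⁻_v) or a candidate for next_v(i) closer to i than x. This gives the first
-- part, and it makes T[v,i], T[x,i], T[v,x] and T[x,x] all cost s_x, so the identity reduces to
-- cost(v,i) + cost(x,x) = cost(v,x) + cost(x,i). Both inequalities come from one exchange: from
-- partitions of T_v containing T[v,a] and of T_x containing T[x,b], with a, b ∈ T_x, build
-- partitions of T_v containing T[v,b] and of T_x containing T[x,a] by swapping the two lower
-- ends and moving the chains of the first partition that are topped inside T_x to the second.
-- Chains of the first partition topped outside T_x avoid T_x, since x already lies on T[v,a].

module Submission where

open import Defs
open import Data.Nat using (ℕ)
open import Data.Fin using (Fin)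
open import Data.Rational using (ℚ; _-_)
open import Data.Product using (_×_)
open import Relation.Binary.PropositionalEquality using (_≡_)

import Data.Nat as ℕ
import Data.Nat.Properties as ℕₚ
open import Data.Empty using (⊥-elim)
open import Data.Fin using (_≟_)
open import Data.List using (List; []; _∷_; [_]; _++_; filter; length)
open import Data.List.Membership.Propositional using (_∈_; find)
open import Data.List.Membership.Propositional.Properties using (∈-∃++)
import Data.List.Membership.DecPropositional as DecMembership
open import Data.List.Properties using (filter-++; length-++; filter-none; filter-some; partition-defn)
open import Data.List.Relation.Binary.Permutation.Propositional using (_↭_; ↭⇒↭ₛ; ↭ₛ⇒↭)
open import Data.List.Relation.Binary.Permutation.Propositional.Properties
  using (↭-length; filter-↭; map⁺; shift; All-resp-↭)
import Data.List.Relation.Binary.Permutation.Setoid.Properties as Permutationₛ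
open import Data.List.Relation.Unary.All as All using (All; []; _∷_)
open import Data.List.Relation.Unary.All.Properties using (¬Any⇒All¬; all-filter; filter⁺; ++⁺)
open import Data.List.Relation.Unary.Any using (here; there)
open import Data.Maybe using (just)
open import Data.Product using (_,_; proj₁; proj₂; ∃-syntax; uncurry)
open import Data.Rational using (0ℚ; _+_; _≤_; _<_)
import Data.Rational.Properties as ℚ
open import Data.Rational.Solver using (module +-*-Solver)
open import Data.Sum using (_⊎_; inj₁; inj₂)
open import Function using (_∘_)
open import Relation.Binary.PropositionalEquality
  using (_≢_; refl; sym; trans; cong; cong₂; subst; module ≡-Reasoning) renaming (setoid to ≡-setoid)
open import Relation.Binary.PropositionalEquality.WithK using (≡-irrelevant)
open import Relation.Nullary using (¬_; Dec; yes; no)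
open import Relation.Unary.Properties using (∁?)

p≤q+p : ∀ p {q} → 0ℚ ≤ q → p ≤ q + p
p≤q+p p {q} 0≤q = subst (_≤ q + p) (ℚ.+-identityˡ p) (ℚ.+-monoˡ-≤ p 0≤q)

p+s≡r+q⇒p-q≡r-s : ∀ p q r s → p + s ≡ r + q → p - q ≡ r - s
p+s≡r+q⇒p-q≡r-s p q r s eq = begin
  p - q               ≡⟨ extend p q s ⟩
  (p + s) - (q + s)   ≡⟨ cong (_- (q + s)) eq ⟩
  (r + q) - (q + s)   ≡⟨ cancel r q s ⟩
  r - s               ∎
  where
  open ≡-Reasoning
  open +-*-Solver
  extend : ∀ p q s → p - q ≡ (p + s) - (q + s)
  extend = solve 3 (λ p q s → p :- q := (p :+ s) :- (q :+ s)) refl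
  cancel : ∀ r q s → (r + q) - (q + s) ≡ r - s
  cancel = solve 3 (λ r q s → (r :+ q) :- (q :+ s) := r :- s) refl

module _ {n : ℕ} (I : Instance n) where
  open Instance I
  open RootedTree tree

  infix 4 _⊑_
  _⊑_ : Fin n → Fin n → Set
  u ⊑ v = Desc parent u v

  ⊑-trans : ∀ {a b c} → a ⊑ b → b ⊑ c → a ⊑ c
  ⊑-trans here        e = e
  ⊑-trans (step eq d) e = step eq (⊑-trans d e)

  ⊑-comparable : ∀ {u a b} → u ⊑ a → u ⊑ b → a ⊑ b ⊎ b ⊑ a
  ⊑-comparable here        e            = inj₁ e
  ⊑-comparable (step eq d) here         = inj₂ (step eq d)
  ⊑-comparable (step eq d) (step eq′ e) with trans (sym eq) eq′
  ... | refl = ⊑-comparable d e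

  ⊑-parent : ∀ {p q r} → parent p ≡ just q → p ⊑ r → p ≡ r ⊎ q ⊑ r
  ⊑-parent eq here         = inj₁ refl
  ⊑-parent eq (step eq′ d) with trans (sym eq) eq′
  ... | refl = inj₂ d

  Cycle : Fin n → Set
  Cycle y = ∃[ p ] (parent y ≡ just p × p ⊑ y)

  cycle-parent : ∀ {y p} → Cycle y → parent y ≡ just p → Cycle p
  cycle-parent (q , eq , d) eq′ with trans (sym eq) eq′
  cycle-parent (q , eq , here)         eq′ | refl = q , eq , here
  cycle-parent (q , eq , step eq″ d)   eq′ | refl = _ , eq″ , ⊑-trans d (step eq here)

  cycle-ancestor : ∀ {a b} → Cycle a → a ⊑ b → Cycle b
  cycle-ancestor c here        = c
  cycle-ancestor c (step eq d) = cycle-ancestor (cycle-parent c eq) d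

  -- A cycle is inherited by every ancestor, in particular by the parentless root.
  no-cycle : ∀ {a} → ¬ Cycle a
  no-cycle {a} c with cycle-ancestor c (reach a)
  ... | _ , eq , _ with trans (sym root-parent) eq
  ... | ()

  ⊑-antisym : ∀ {a b} → a ⊑ b → b ⊑ a → a ≡ b
  ⊑-antisym here        e = refl
  ⊑-antisym (step eq d) e = ⊥-elim (no-cycle (_ , eq , ⊑-trans d e))

  ⊑-irrelevant : ∀ {a b} (d e : a ⊑ b) → d ≡ e
  ⊑-irrelevant here         here         = refl
  ⊑-irrelevant here         (step eq e)  = ⊥-elim (no-cycle (_ , eq , e))
  ⊑-irrelevant (step eq d)  here         = ⊥-elim (no-cycle (_ , eq , d))
  ⊑-irrelevant (step eq d)  (step eq′ e) with trans (sym eq) eq′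
  ... | refl with ⊑-irrelevant d e | ≡-irrelevant eq eq′
  ... | refl | refl = refl

  ∈-path⁻ : ∀ {b t y} (d : b ⊑ t) → y ∈ pathList I d → b ⊑ y × y ⊑ t
  ∈-path⁻ here        (here refl) = here , here
  ∈-path⁻ (step eq d) (here refl) = here , step eq d
  ∈-path⁻ (step eq d) (there m)   = let by , yt = ∈-path⁻ d m in step eq by , yt

  ∈-path-⊑-trans : ∀ {b y t} (d : b ⊑ y) (e : y ⊑ t) → y ∈ pathList I (⊑-trans d e)
  ∈-path-⊑-trans here        here       = here refl
  ∈-path-⊑-trans here        (step _ _) = here refl
  ∈-path-⊑-trans (step _ d)  e          = there (∈-path-⊑-trans d e)

  ∈-path⁺ : ∀ {b y t} → b ⊑ y → y ⊑ t → (d : b ⊑ t) → y ∈ pathList I d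
  ∈-path⁺ by yt d = subst (λ d → _ ∈ pathList I d) (⊑-irrelevant (⊑-trans by yt) d) (∈-path-⊑-trans by yt)

  _⊑?_ : ∀ u x → Dec (u ⊑ x)
  u ⊑? x with DecMembership._∈?_ _≟_ x (pathList I (reach u))
  ... | yes m = yes (proj₁ (∈-path⁻ (reach u) m))
  ... | no ¬m = no (λ ux → ¬m (∈-path⁺ ux (reach x) (reach u)))

  pathWeight-nonneg : ∀ {b t} (d : b ⊑ t) → 0ℚ ≤ pathWeight I d
  pathWeight-nonneg {b} here       = p≤q+p 0ℚ (w-nonneg b)
  pathWeight-nonneg {b} (step _ d) = ℚ.≤-trans (pathWeight-nonneg d) (p≤q+p _ (w-nonneg b))

  pathWeight-⊑-transˡ : ∀ {a b c} (d : a ⊑ b) (e : b ⊑ c) → pathWeight I d ≤ pathWeight I (⊑-trans d e)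
  pathWeight-⊑-transˡ {a} here       here       = ℚ.≤-refl
  pathWeight-⊑-transˡ {a} here       (step _ e) = ℚ.+-monoʳ-≤ (w a) (pathWeight-nonneg e)
  pathWeight-⊑-transˡ {a} (step _ d) e          = ℚ.+-monoʳ-≤ (w a) (pathWeight-⊑-transˡ d e)

  pathWeight-⊑-transʳ : ∀ {a b c} (d : a ⊑ b) (e : b ⊑ c) → pathWeight I e ≤ pathWeight I (⊑-trans d e)
  pathWeight-⊑-transʳ     here       e = ℚ.≤-refl
  pathWeight-⊑-transʳ {a} (step _ d) e = ℚ.≤-trans (pathWeight-⊑-transʳ d e) (p≤q+p _ (w-nonneg a))

  pathMaxS-lub : ∀ {b t m} (d : b ⊑ t) → (∀ y → b ⊑ y → y ⊑ t → s y ≤ m) → pathMaxS I d ≤ m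
  pathMaxS-lub {b} here        bound = bound b here here
  pathMaxS-lub {b} (step eq d) bound =
    ℚ.⊔-lub (bound b here (step eq d)) (pathMaxS-lub d (λ y py yt → bound y (step eq py) yt))

  pathMaxS-upper : ∀ {b t y} (d : b ⊑ t) → y ∈ pathList I d → s y ≤ pathMaxS I d
  pathMaxS-upper     here       (here refl) = ℚ.≤-refl
  pathMaxS-upper {b} (step _ d) (here refl) = ℚ.p≤p⊔q (s b) (pathMaxS I d)
  pathMaxS-upper {b} (step _ d) (there m)   = ℚ.≤-trans (pathMaxS-upper d m) (ℚ.p≤q⊔p (s b) (pathMaxS I d))

  pathMaxS-attained : ∀ {b t x} (d : b ⊑ t) → b ⊑ x → x ⊑ t →
                      (∀ y → b ⊑ y → y ⊑ t → s y ≤ s x) → pathMaxS I d ≡ s x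
  pathMaxS-attained d bx xt bound = ℚ.≤-antisym (pathMaxS-lub d bound) (pathMaxS-upper d (∈-path⁺ bx xt d))

  infix 4 _∈ᶜ_ _∉ᶜ_
  _∈ᶜ_ _∉ᶜ_ : Fin n → Chain I → Set
  u ∈ᶜ c = u ∈ pathList I (path c)
  u ∉ᶜ c = ¬ u ∈ᶜ c

  countContaining-++ : ∀ u cs ds →
    countContaining I u (cs ++ ds) ≡ countContaining I u cs ℕ.+ countContaining I u ds
  countContaining-++ u cs ds = trans (cong length (filter-++ _ cs ds)) (length-++ (filter _ cs))

  countContaining-↭ : ∀ u {cs ds} → cs ↭ ds → countContaining I u cs ≡ countContaining I u ds
  countContaining-↭ u cs↭ds = ↭-length (filter-↭ _ cs↭ds)

  countContaining-none : ∀ u {cs} → All (u ∉ᶜ_) cs → countContaining I u cs ≡ 0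
  countContaining-none u none = cong length (filter-none _ none)

  countContaining-none⁻ : ∀ u cs → countContaining I u cs ≡ 0 → All (u ∉ᶜ_) cs
  countContaining-none⁻ u cs zero = ¬Any⇒All¬ cs (λ some → ℕₚ.<-irrefl (sym zero) (filter-some _ some))

  countContaining-[]-∈ : ∀ {u} c → u ∈ᶜ c → countContaining I u [ c ] ≡ 1
  countContaining-[]-∈ {u} c u∈c with DecMembership._∈?_ _≟_ u (pathList I (path c))
  ... | yes _   = refl
  ... | no  u∉c = ⊥-elim (u∉c u∈c)

  countContaining-[]-∉ : ∀ {u} c → u ∉ᶜ c → countContaining I u [ c ] ≡ 0
  countContaining-[]-∉ c u∉c = countContaining-none _ (u∉c ∷ [])

  countContaining-[]-cong : ∀ {u} c c′ → (u ∈ᶜ c → u ∈ᶜ c′) → (u ∈ᶜ c′ → u ∈ᶜ c) →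
                            countContaining I u [ c ] ≡ countContaining I u [ c′ ]
  countContaining-[]-cong {u} c c′ to from with DecMembership._∈?_ _≟_ u (pathList I (path c))
  ... | yes u∈c = sym (countContaining-[]-∈ c′ (to u∈c))
  ... | no  u∉c = sym (countContaining-[]-∉ c′ (λ u∈c′ → u∉c (from u∈c′)))

  partitionCost-++ : ∀ cs ds → partitionCost I (cs ++ ds) ≡ partitionCost I cs + partitionCost I ds
  partitionCost-++ []       ds = sym (ℚ.+-identityˡ _)
  partitionCost-++ (c ∷ cs) ds = trans (cong (pathMaxS I (path c) +_) (partitionCost-++ cs ds))
                                       (sym (ℚ.+-assoc (pathMaxS I (path c)) _ _))

  partitionCost-↭ : ∀ {cs ds} → cs ↭ ds → partitionCost I cs ≡ partitionCost I ds
  partitionCost-↭ cs↭ds =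
    Permutationₛ.foldr-commMonoid (≡-setoid ℚ) ℚ.+-0-isCommutativeMonoid (↭⇒↭ₛ (map⁺ _ cs↭ds))

  ∈ᶜ⁻ : ∀ {u} c → u ∈ᶜ c → bot c ⊑ u × u ⊑ top c
  ∈ᶜ⁻ c = ∈-path⁻ (path c)

  ∈ᶜ⁺ : ∀ {u} c → bot c ⊑ u → u ⊑ top c → u ∈ᶜ c
  ∈ᶜ⁺ c bu ut = ∈-path⁺ bu ut (path c)

  ∉ᶜ-outside : ∀ {x u} c → top c ⊑ x → ¬ u ⊑ x → u ∉ᶜ c
  ∉ᶜ-outside c tx ¬ux u∈c = ¬ux (⊑-trans (proj₂ (∈ᶜ⁻ c u∈c)) tx)

  ∉ᶜ-below : ∀ {x u} c → ¬ top c ⊑ x → x ∉ᶜ c → u ⊑ x → u ∉ᶜ c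
  ∉ᶜ-below c ¬tx x∉c ux u∈c with ∈ᶜ⁻ c u∈c
  ... | bu , ut with ⊑-comparable ux ut
  ... | inj₁ xt = x∉c (∈ᶜ⁺ c (⊑-trans bu ux) xt)
  ... | inj₂ tx = ¬tx tx

  inside outside : Fin n → List (Chain I) → List (Chain I)
  inside  x = filter (λ c → top c ⊑? x)
  outside x = filter (∁? (λ c → top c ⊑? x))

  inside-outside-↭ : ∀ x cs → cs ↭ inside x cs ++ outside x cs
  inside-outside-↭ x cs =
    subst (cs ↭_) (cong (uncurry _++_) (partition-defn P? cs))
          (↭ₛ⇒↭ (Permutationₛ.partition-↭ (≡-setoid (Chain I)) P? cs))
    where P? = λ c → top c ⊑? x

  extract-chain : ∀ {v a cs} (d : a ⊑ v) → HasChain I v a cs → ∃[ rest ] cs ↭ chain v a d ∷ rest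
  extract-chain d has with find has
  ... | chain _ _ p , c∈cs , refl , refl with ∈-∃++ c∈cs
  ... | pre , post , refl rewrite ⊑-irrelevant p d = pre ++ post , shift _ pre post

  ChainPartition-↭ : ∀ {v cs ds} → cs ↭ ds → ChainPartition I v cs → ChainPartition I v ds
  ChainPartition-↭ cs↭ds (tops , weights , counts) =
    All-resp-↭ cs↭ds tops , All-resp-↭ cs↭ds weights ,
    λ u uv → trans (sym (countContaining-↭ u cs↭ds)) (counts u uv)

  countContaining-∷ : ∀ u c cs →
    countContaining I u (c ∷ cs) ≡ countContaining I u [ c ] ℕ.+ countContaining I u cs
  countContaining-∷ u c = countContaining-++ u [ c ]

  countContaining-∷-cong : ∀ u c c′ cs cs′ →
    countContaining I u [ c ] ≡ countContaining I u [ c′ ] → countContaining I u cs ≡ countContaining I u cs′ →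
    countContaining I u (c ∷ cs) ≡ countContaining I u (c′ ∷ cs′)
  countContaining-∷-cong u c c′ cs cs′ c≈c′ cs≈cs′ =
    trans (countContaining-∷ u c cs) (trans (cong₂ ℕ._+_ c≈c′ cs≈cs′) (sym (countContaining-∷ u c′ cs′)))

  countContaining-inside-outside : ∀ u x cs →
    countContaining I u cs ≡ countContaining I u (inside x cs) ℕ.+ countContaining I u (outside x cs)
  countContaining-inside-outside u x cs =
    trans (countContaining-↭ u (inside-outside-↭ x cs)) (countContaining-++ u (inside x cs) (outside x cs))

  partitionCost-inside-outside : ∀ x cs →
    partitionCost I cs ≡ partitionCost I (inside x cs) + partitionCost I (outside x cs)
  partitionCost-inside-outside x cs =
    trans (partitionCost-↭ (inside-outside-↭ x cs)) (partitionCost-++ (inside x cs) (outside x cs))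

  countContaining-inside-subtree : ∀ {x u} cs → All (λ c → top c ⊑ x) cs → ¬ u ⊑ x →
                                   countContaining I u cs ≡ 0
  countContaining-inside-subtree cs tops ¬ux =
    countContaining-none _ (All.map (λ {c} tx → ∉ᶜ-outside c tx ¬ux) tops)

  countContaining-avoiding : ∀ {x u} cs → All (λ c → ¬ top c ⊑ x) cs → All (x ∉ᶜ_) cs → u ⊑ x →
                             countContaining I u cs ≡ 0
  countContaining-avoiding cs ¬tops x∉cs ux =
    countContaining-none _ (All.zipWith (λ {c} (¬tx , x∉c) → ∉ᶜ-below c ¬tx x∉c ux) (¬tops , x∉cs))

  countContaining-[]-lower : ∀ {u x v b} (bx : b ⊑ x) (xv : x ⊑ v) (d : b ⊑ v) → u ⊑ x →
    countContaining I u [ chain v b d ] ≡ countContaining I u [ chain x b bx ]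
  countContaining-[]-lower bx xv d ux = countContaining-[]-cong (chain _ _ d) (chain _ _ bx)
    (λ m → ∈ᶜ⁺ (chain _ _ bx) (proj₁ (∈-path⁻ d m)) ux)
    (λ m → let bu , ux′ = ∈-path⁻ bx m in ∈ᶜ⁺ (chain _ _ d) bu (⊑-trans ux′ xv))

  above-of-outside : ∀ {a x u} → a ⊑ x → a ⊑ u → ¬ u ⊑ x → x ⊑ u
  above-of-outside ax au ¬ux with ⊑-comparable au ax
  ... | inj₁ ux = ⊥-elim (¬ux ux)
  ... | inj₂ xu = xu

  countContaining-[]-upper : ∀ {u x v a b} (ax : a ⊑ x) (bx : b ⊑ x) (d : a ⊑ v) (e : b ⊑ v) → ¬ u ⊑ x →
    countContaining I u [ chain v a d ] ≡ countContaining I u [ chain v b e ]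
  countContaining-[]-upper ax bx d e ¬ux = countContaining-[]-cong (chain _ _ d) (chain _ _ e)
    (λ m → let au , uv = ∈-path⁻ d m in ∈ᶜ⁺ (chain _ _ e) (⊑-trans bx (above-of-outside ax au ¬ux)) uv)
    (λ m → let bu , uv = ∈-path⁻ e m in ∈ᶜ⁺ (chain _ _ d) (⊑-trans ax (above-of-outside bx bu ¬ux)) uv)

  exchange :
    ∀ {v x a b R R′} (xv : x ⊑ v) (ax : a ⊑ x) (bx : b ⊑ x) →
    ChainPartition I v (chain v a (⊑-trans ax xv) ∷ R) →
    ChainPartition I x (chain x b bx ∷ R′) →
    pathWeight I (⊑-trans bx xv) ≤ w0 → pathWeight I ax ≤ w0 →
    ChainPartition I v (chain v b (⊑-trans bx xv) ∷ outside x R ++ R′) ×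
    ChainPartition I x (chain x a ax ∷ inside x R)
  exchange {v} {x} {a} {b} {R} {R′} xv ax bx
           (_ ∷ tops , _ ∷ weights , counts) (_ ∷ tops′ , _ ∷ weights′ , counts′) wvb wxa =
      ( here ∷ ++⁺ (filter⁺ _ tops) (All.map (λ tx → ⊑-trans tx xv) tops′)
      , wvb ∷ ++⁺ (filter⁺ _ weights) weights′
      , countsᵥ )
    , (here ∷ all-filter _ R , wxa ∷ filter⁺ _ weights , countsₓ)
    where
    open ≡-Reasoning
    count : Fin n → List (Chain I) → ℕ
    count = countContaining I
    Cva = chain v a (⊑-trans ax xv)
    Cvb = chain v b (⊑-trans bx xv)

    x∉R : All (x ∉ᶜ_) R
    x∉R = countContaining-none⁻ x R (ℕₚ.suc-injective (begin
      1 ℕ.+ count x R                ≡⟨ cong (ℕ._+ count x R) (countContaining-[]-∈ Cva (∈ᶜ⁺ Cva ax xv)) ⟨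
      count x [ Cva ] ℕ.+ count x R  ≡⟨ countContaining-∷ x Cva R ⟨
      count x (Cva ∷ R)              ≡⟨ counts x xv ⟩
      1                              ∎))

    outside-below : ∀ {u} → u ⊑ x → count u (outside x R) ≡ 0
    outside-below = countContaining-avoiding (outside x R) (all-filter _ R) (filter⁺ _ x∉R)

    R-below : ∀ {u} → u ⊑ x → count u R ≡ count u (inside x R)
    R-below {u} ux = trans (countContaining-inside-outside u x R)
                           (trans (cong (count u (inside x R) ℕ.+_) (outside-below ux)) (ℕₚ.+-identityʳ _))

    R-above : ∀ {u} → ¬ u ⊑ x → count u R ≡ count u (outside x R)
    R-above {u} ¬ux =
      trans (countContaining-inside-outside u x R)
            (cong (ℕ._+ count u (outside x R)) (countContaining-inside-subtree (inside x R) (all-filter _ R) ¬ux))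

    outside++R′-below : ∀ {u} → u ⊑ x → count u (outside x R ++ R′) ≡ count u R′
    outside++R′-below {u} ux =
      trans (countContaining-++ u (outside x R) R′) (cong (ℕ._+ count u R′) (outside-below ux))

    outside++R′-above : ∀ {u} → ¬ u ⊑ x → count u (outside x R ++ R′) ≡ count u R
    outside++R′-above {u} ¬ux = begin
      count u (outside x R ++ R′)          ≡⟨ countContaining-++ u (outside x R) R′ ⟩
      count u (outside x R) ℕ.+ count u R′ ≡⟨ cong (count u (outside x R) ℕ.+_)
                                                    (countContaining-inside-subtree R′ tops′ ¬ux) ⟩
      count u (outside x R) ℕ.+ 0          ≡⟨ ℕₚ.+-identityʳ _ ⟩
      count u (outside x R)                ≡⟨ R-above ¬ux ⟨
      count u R                            ∎

    countsᵥ : ∀ u → u ⊑ v → count u (Cvb ∷ outside x R ++ R′) ≡ 1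
    countsᵥ u uv with u ⊑? x
    ... | yes ux = trans (countContaining-∷-cong u Cvb (chain x b bx) (outside x R ++ R′) R′
                            (countContaining-[]-lower bx xv (⊑-trans bx xv) ux) (outside++R′-below ux))
                         (counts′ u ux)
    ... | no ¬ux = trans (countContaining-∷-cong u Cvb Cva (outside x R ++ R′) R
                            (countContaining-[]-upper bx ax (⊑-trans bx xv) (⊑-trans ax xv) ¬ux)
                            (outside++R′-above ¬ux))
                         (counts u uv)

    countsₓ : ∀ u → u ⊑ x → count u (chain x a ax ∷ inside x R) ≡ 1
    countsₓ u ux = trans (countContaining-∷-cong u (chain x a ax) Cva (inside x R) R
                            (sym (countContaining-[]-lower ax xv (⊑-trans ax xv) ux)) (sym (R-below ux)))
                         (counts u (⊑-trans ux xv))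

  exchange-cost :
    ∀ {v x a b R R′} (xv : x ⊑ v) (ax : a ⊑ x) (bx : b ⊑ x) →
    pathMaxS I (⊑-trans ax xv) + pathMaxS I bx ≡ pathMaxS I (⊑-trans bx xv) + pathMaxS I ax →
    partitionCost I (chain v b (⊑-trans bx xv) ∷ outside x R ++ R′) +
    partitionCost I (chain x a ax ∷ inside x R) ≡
    partitionCost I (chain v a (⊑-trans ax xv) ∷ R) + partitionCost I (chain x b bx ∷ R′)
  exchange-cost {x = x} {R = R} {R′} xv ax bx maxima = begin
    (mvb + cost (outside x R ++ R′)) + (mxa + cost (inside x R))
      ≡⟨ cong (λ k → (mvb + k) + (mxa + cost (inside x R))) (partitionCost-++ (outside x R) R′) ⟩
    (mvb + (cost (outside x R) + cost R′)) + (mxa + cost (inside x R))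
      ≡⟨ regroupˡ mvb mxa (cost (inside x R)) (cost (outside x R)) (cost R′) ⟩
    (mvb + mxa) + ((cost (inside x R) + cost (outside x R)) + cost R′)
      ≡⟨ cong₂ (λ m k → m + (k + cost R′)) maxima (partitionCost-inside-outside x R) ⟨
    (mva + mxb) + (cost R + cost R′)
      ≡⟨ regroupʳ mva mxb (cost R) (cost R′) ⟩
    (mva + cost R) + (mxb + cost R′) ∎
    where
    open ≡-Reasoning
    open +-*-Solver
    cost = partitionCost I
    mva = pathMaxS I (⊑-trans ax xv)
    mvb = pathMaxS I (⊑-trans bx xv)
    mxa = pathMaxS I ax
    mxb = pathMaxS I bx
    regroupˡ : ∀ m m′ p q r → (m + (q + r)) + (m′ + p) ≡ (m + m′) + ((p + q) + r)
    regroupˡ = solve 5 (λ m m′ p q r → (m :+ (q :+ r)) :+ (m′ :+ p) := (m :+ m′) :+ ((p :+ q) :+ r)) refl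
    regroupʳ : ∀ m m′ p q → (m + m′) + (p + q) ≡ (m + p) + (m′ + q)
    regroupʳ = solve 4 (λ m m′ p q → (m :+ m′) :+ (p :+ q) := (m :+ p) :+ (m′ :+ q)) refl

  IsCost-exchange :
    ∀ {v x a b c₁ c₂ c₃ c₄} (xv : x ⊑ v) (ax : a ⊑ x) (bx : b ⊑ x) →
    pathWeight I (⊑-trans bx xv) ≤ w0 → pathWeight I ax ≤ w0 →
    pathMaxS I (⊑-trans ax xv) + pathMaxS I bx ≡ pathMaxS I (⊑-trans bx xv) + pathMaxS I ax →
    IsCost I v a c₁ → IsCost I x b c₂ → IsCost I v b c₃ → IsCost I x a c₄ → c₃ + c₄ ≤ c₁ + c₂
  IsCost-exchange {v} {x} {a} {b} {c₃ = c₃} {c₄} xv ax bx wvb wxa maxima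
                  ((P , partP , hasP , refl) , _) ((P′ , partP′ , hasP′ , refl) , _) (_ , optimal₃) (_ , optimal₄)
    with extract-chain (⊑-trans ax xv) hasP | extract-chain bx hasP′
  ... | R , P↭ | R′ , P′↭ = begin
    c₃ + c₄
      ≤⟨ ℚ.+-mono-≤ (optimal₃ _ partQ (here (refl , refl))) (optimal₄ _ partQ′ (here (refl , refl))) ⟩
    cost Q + cost Q′
      ≡⟨ exchange-cost {R = R} {R′} xv ax bx maxima ⟩
    cost (chain v a (⊑-trans ax xv) ∷ R) + cost (chain x b bx ∷ R′)
      ≡⟨ cong₂ _+_ (partitionCost-↭ P↭) (partitionCost-↭ P′↭) ⟨
    cost P + cost P′ ∎
    where
    open ℚ.≤-Reasoning
    cost = partitionCost I
    Q = chain v b (⊑-trans bx xv) ∷ outside x R ++ R′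
    Q′ = chain x a ax ∷ inside x R
    partitions = exchange xv ax bx (ChainPartition-↭ P↭ partP) (ChainPartition-↭ P′↭ partP′) wvb wxa
    partQ = proj₁ partitions
    partQ′ = proj₂ partitions

  SMax-bound : ∀ {v x y} → SMax I v x → x ⊑ y → y ⊑ v → s y ≤ s x
  SMax-bound {x = x} {y} (_ , larger) xy yv with y ≟ x
  ... | yes refl = ℚ.≤-refl
  ... | no  y≢x  = ℚ.<⇒≤ (larger y ((yv , xy) , y≢x))

  module Next {v i x : Fin n} (i∈win⁻ : WinMinus I v i) (x-next : IsNext I v i x) where

    iv : i ⊑ v
    iv = proj₁ (proj₁ i∈win⁻)

    xv : x ⊑ v
    xv = proj₁ (proj₁ (proj₁ x-next))

    ix : i ⊑ x
    ix = proj₂ (proj₁ (proj₁ x-next))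

    x≢i : x ≢ i
    x≢i = proj₂ (proj₁ x-next)

    x-s-maximal : SMax I v x
    x-s-maximal = proj₁ (proj₂ x-next)

    ¬s-maximal-below : ∀ {p q} → parent p ≡ just q → q ⊑ x → i ⊑ p → ¬ SMax I v p
    ¬s-maximal-below {p} eq qx ip p-s-maximal with p ≟ i
    ... | yes refl = proj₂ i∈win⁻ p-s-maximal
    ... | no  p≢i  = no-cycle (_ , eq , ⊑-trans qx x⊑p)
      where x⊑p = proj₂ (proj₂ x-next) p ((proj₁ p-s-maximal , ip) , p≢i) p-s-maximal

    s-maximal-if-exceeds : ∀ {p q} → parent p ≡ just q → q ⊑ x →
                           (∀ {r} → q ⊑ r → r ⊑ x → s r ≤ s x) → s x < s p → SMax I v p
    s-maximal-if-exceeds {p} eq qx bounded sx<sp = step eq (⊑-trans qx xv) , larger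
      where
      larger : ∀ y → InPathOpen I v p y → s y < s p
      larger y ((yv , py) , y≢p) with ⊑-parent eq py
      ... | inj₁ p≡y = ⊥-elim (y≢p (sym p≡y))
      ... | inj₂ qy with ⊑-comparable qy qx
      ...   | inj₁ yx = ℚ.≤-<-trans (bounded qy yx) sx<sp
      ...   | inj₂ xy = ℚ.≤-<-trans (SMax-bound x-s-maximal xy yv) sx<sp

    s-bound-below : ∀ {p} → p ⊑ x → i ⊑ p → ∀ {r} → p ⊑ r → r ⊑ x → s r ≤ s x
    s-bound-below here ip pr rx with refl ← ⊑-antisym pr rx = ℚ.≤-refl
    s-bound-below (step eq qx) ip pr rx with ⊑-parent eq pr
    ... | inj₂ qr   = s-bound-below qx (⊑-trans ip (step eq here)) qr rx
    ... | inj₁ refl = ℚ.≮⇒≥ (¬s-maximal-below eq qx ip ∘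
                             s-maximal-if-exceeds eq qx (s-bound-below qx (⊑-trans ip (step eq here))))

    s-bound : ∀ {y} → i ⊑ y → y ⊑ v → s y ≤ s x
    s-bound iy yv with ⊑-comparable iy ix
    ... | inj₁ yx = s-bound-below ix here iy yx
    ... | inj₂ xy = SMax-bound x-s-maximal xy yv

    pathMaxS-next : ∀ {b t} (d : b ⊑ t) → i ⊑ b → b ⊑ x → x ⊑ t → t ⊑ v → pathMaxS I d ≡ s x
    pathMaxS-next d ib bx xt tv = pathMaxS-attained d bx xt (λ y by yt → s-bound (⊑-trans ib by) (⊑-trans yt tv))

    pathWeight-vi : pathWeight I (⊑-trans ix xv) ≤ w0
    pathWeight-vi = subst (λ d → pathWeight I d ≤ w0) (⊑-irrelevant iv (⊑-trans ix xv)) (proj₂ (proj₁ i∈win⁻))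

    pathWeight-xi : pathWeight I ix ≤ w0
    pathWeight-xi = ℚ.≤-trans (pathWeight-⊑-transˡ ix xv) pathWeight-vi

    pathWeight-vx : pathWeight I xv ≤ w0
    pathWeight-vx = ℚ.≤-trans (pathWeight-⊑-transʳ ix xv) pathWeight-vi

    pathWeight-xx : pathWeight I (here {v = x}) ≤ w0
    pathWeight-xx = subst (_≤ w0) (sym (ℚ.+-identityʳ (w x))) (w-le-w0 x)

    win⁻-next : WinMinus I x i
    win⁻-next = (ix , pathWeight-xi) , λ i-s-maximalₓ → proj₂ i∈win⁻ (iv , larger i-s-maximalₓ)
      where
      larger : SMax I x i → ∀ p → InPathOpen I v i p → s p < s i
      larger (_ , largerₓ) p ((pv , ip) , p≢i) with ⊑-comparable ip ix
      ... | inj₁ px = largerₓ p ((px , ip) , p≢i)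
      ... | inj₂ xp = ℚ.≤-<-trans (SMax-bound x-s-maximal xp pv) (largerₓ x ((here , ix) , x≢i))

    next-next : IsNext I x i x
    next-next = ((here , ix) , x≢i) , (here , λ p ((px , xp) , p≢x) → ⊥-elim (p≢x (⊑-antisym px xp))) , closest
      where
      closest : ∀ p → InPathOpen I x i p → SMax I x p → x ⊑ p
      closest p ((px , ip) , p≢i) (_ , largerₓ) with p ≟ x
      ... | yes refl = here
      ... | no  p≢x  = proj₂ (proj₂ x-next) p ((⊑-trans px xv , ip) , p≢i) (⊑-trans px xv , larger)
        where
        larger : ∀ y → InPathOpen I v p y → s y < s p
        larger y ((yv , py) , y≢p) with ⊑-comparable py px
        ... | inj₁ yx = largerₓ y ((yx , py) , y≢p)
        ... | inj₂ xy = ℚ.≤-<-trans (SMax-bound x-s-maximal xy yv) (largerₓ x ((here , px) , p≢x ∘ sym))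

    cost-vi+cost-xx≡cost-vx+cost-xi : ∀ {c₁ c₂ c₃ c₄} →
      IsCost I v i c₁ → IsCost I x i c₂ → IsCost I v x c₃ → IsCost I x x c₄ → c₁ + c₄ ≡ c₃ + c₂
    cost-vi+cost-xx≡cost-vx+cost-xi cost-vi cost-xi cost-vx cost-xx = ℚ.≤-antisym
      (IsCost-exchange xv here ix pathWeight-vi pathWeight-xx maxima cost-vx cost-xi cost-vi cost-xx)
      (IsCost-exchange xv ix here pathWeight-vx pathWeight-xi (sym maxima) cost-vi cost-xx cost-vx cost-xi)
      where
      maxima : pathMaxS I xv + pathMaxS I ix ≡ pathMaxS I (⊑-trans ix xv) + pathMaxS I (here {v = x})
      maxima = cong₂ _+_ (trans (pathMaxS-next xv ix here xv here)
                                (sym (pathMaxS-next (⊑-trans ix xv) here ix xv here)))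
                         (pathMaxS-next ix here ix here xv)

lemma1 : ∀ {n : ℕ} (I : Instance n) (v i x : Fin n) →
         WinMinus I v i → IsNext I v i x →
         (WinMinus I x i × IsNext I x i x) ×
         (∀ c₁ c₂ c₃ c₄ → IsCost I v i c₁ → IsCost I x i c₂ →
            IsCost I v x c₃ → IsCost I x x c₄ → c₁ - c₂ ≡ c₃ - c₄)
lemma1 I v i x i∈win⁻ x-next =
  (win⁻-next , next-next) ,
  λ c₁ c₂ c₃ c₄ cost-vi cost-xi cost-vx cost-xx →
    p+s≡r+q⇒p-q≡r-s c₁ c₂ c₃ c₄ (cost-vi+cost-xx≡cost-vx+cost-xi cost-vi cost-xi cost-vx cost-xx)
  where open Next I i∈win⁻ x-next
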